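{- Let $n,m$ be positive integers, let $G$ be a starting host graph consisting of two vertex-disjoint blue paths $P_n$ and $P_m$ (and no other colored edges), and let $H$ be a bipartite graph. Then $\tilde{r}_G(H,P_{n+m-v(H)})\le e(H)$, where $v(H)$ and $e(H)$ are the numbers of vertices and edges of $H$.
   Context: $P_k$ denotes the path on $k$ vertices. For graphs $H_1,H_2$ and a partially colored (red/blue) graph $G$ on vertex set $\mathbb N$, the game $\mathcal R_G(H_1,H_2)$ is the online Ramsey game played on the edge set of $K_{\mathbb N}$ starting from the colored edges of $G$: in every round Builder selects a previously unselected (uncolored) edge and Painter colors it red or blue; the game ends as soon as, after a move of Painter (or already at the start), the colored graph contains a red copy of $H_1$ or a blue copy of $H_2$. Builder tries to end the game as soon as possible, Painter tries to delay it. $\tilde{r}_G(H_1,H_2)$ is the number of rounds of this game when both players play optimally. -}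

module Defs where

open import Data.Nat using (ℕ; zero; suc; _+_; _≡ᵇ_; _<ᵇ_)
open import Data.Bool using (Bool; true; false; if_then_else_; _∧_; _∨_; not)
open import Data.Bool.Properties using (∨-comm)
open import Data.Fin using (Fin; toℕ)
open import Data.List using (List; map; allFin)
open import Data.Nat.ListAction using (sum)
open import Data.Maybe using (Maybe; just; nothing)
open import Data.Product using (Σ; _×_)
open import Data.Sum using (_⊎_)
open import Function.Definitions using (Injective)
open import Relation.Binary.PropositionalEquality using (_≡_; _≢_; refl)

data Colour : Set where
  red blue : Colour

-- A (partial) colouring of the edges of K_ℕ: C x y = nothing means the
-- edge {x,y} is uncoloured. Colourings built below are symmetric.
Coloring : Set
Coloring = ℕ → ℕ → Maybe Colour

record Graph : Set where
  field
    size   : ℕ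
    adj    : Fin size → Fin size → Bool
    sym    : ∀ i j → adj i j ≡ adj j i
    irrefl : ∀ i → adj i i ≡ false
open Graph public

v : Graph → ℕ
v H = size H

e : Graph → ℕ
e H = sum (map (λ i → sum (map (λ j → if (toℕ i <ᵇ toℕ j) ∧ adj H i j then 1 else 0)
                                 (allFin (size H))))
               (allFin (size H)))

Bipartite : Graph → Set
Bipartite H = Σ (Fin (size H) → Bool) λ s → ∀ i j → adj H i j ≡ true → s i ≢ s j

private
  suc≢ᵇ : ∀ x → (suc x ≡ᵇ x) ≡ false
  suc≢ᵇ zero = refl
  suc≢ᵇ (suc x) = suc≢ᵇ x

Path : ℕ → Graph
Path k = record
  { size = k
  ; adj = λ i j → (suc (toℕ i) ≡ᵇ toℕ j) ∨ (suc (toℕ j) ≡ᵇ toℕ i)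
  ; sym = λ i j → ∨-comm (suc (toℕ i) ≡ᵇ toℕ j) (suc (toℕ j) ≡ᵇ toℕ i)
  ; irrefl = λ i → irr (toℕ i)
  }
  where
  irr : ∀ x → ((suc x ≡ᵇ x) ∨ (suc x ≡ᵇ x)) ≡ false
  irr x rewrite suc≢ᵇ x = refl

ContainsCopy : Coloring → Colour → Graph → Set
ContainsCopy C c H =
  Σ (Fin (size H) → ℕ) λ f → Injective _≡_ _≡_ f ×
    (∀ i j → adj H i j ≡ true → C (f i) (f j) ≡ just c)

Ended : Coloring → Graph → Graph → Set
Ended C H1 H2 = ContainsCopy C red H1 ⊎ ContainsCopy C blue H2

paint : Coloring → ℕ → ℕ → Colour → Coloring
paint C u w c x y =
  if ((x ≡ᵇ u) ∧ (y ≡ᵇ w)) ∨ ((x ≡ᵇ w) ∧ (y ≡ᵇ u)) then just c else C x y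

-- BuilderWins H1 H2 k C : in the game R_C(H1,H2) Builder can force the end
-- of the game within k rounds, against every Painter strategy.
-- Hence  r̃_C(H1,H2) ≤ k  ⇔  BuilderWins H1 H2 k C.
data BuilderWins (H1 H2 : Graph) : ℕ → Coloring → Set where
  done : ∀ {k C} → Ended C H1 H2 → BuilderWins H1 H2 k C
  step : ∀ {k C} (x y : ℕ) → x ≢ y → C x y ≡ nothing →
         (∀ c → BuilderWins H1 H2 k (paint C x y c)) →
         BuilderWins H1 H2 (suc k) C

-- starting host graph: blue path P_n on 0,…,n-1 and a vertex-disjoint
-- blue path P_m on n,…,n+m-1; no other coloured edges.
twoPathsEdge : ℕ → ℕ → ℕ → ℕ → Bool
twoPathsEdge n m x y =
  (suc x ≡ᵇ y) ∧ ((y <ᵇ n) ∨ (not (x <ᵇ n) ∧ (y <ᵇ n + m)))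

twoPaths : ℕ → ℕ → Coloring
twoPaths n m x y =
  if twoPathsEdge n m x y ∨ twoPathsEdge n m y x then just blue else nothing

{-# OPTIONS --safe #-}
-- If v(H) ≥ n, the blue P_m already contains the required blue path. Otherwise Builder embeds
-- H so that one side of the bipartition occupies n-1, n-2, … (the end of the blue P_n) and the
-- other side n, n+1, … (the start of the blue P_m), each side in index order, and asks for the
-- images of the e(H) edges of H one by one. If Painter answers red every time she has built a
-- red H. If she colours an image edge {u, w} with u < n ≤ w blue, then 0, …, u, w, …, n+m-1
-- is a blue path. It misses only the positions strictly between u and w, which are the images
-- of the vertices preceding the two endpoints on their own sides: fewer than v(H) of them.
module Submission where

open import Defs hiding (sym)
open import Data.Bool using (Bool; true; false; T; if_then_else_; _∧_; _∨_; not)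
open import Data.Bool.Properties using (T-≡; T-∧; T-∨; ∧-comm; ∨-comm; if-float)
open import Data.Fin using (Fin; toℕ; zero; suc)
open import Data.Fin.Properties using (toℕ-injective; toℕ<n)
open import Data.List using (List; []; _∷_; [_]; length; map; concatMap; allFin)
open import Data.List.Properties using (length-++; map-cong)
open import Data.List.Membership.Propositional using (_∈_; lose)
open import Data.List.Membership.Propositional.Properties using (∈-concatMap⁺; ∈-allFin)
open import Data.List.Relation.Unary.All as All using (All; []; _∷_)
open import Data.List.Relation.Unary.All.Properties using (concat⁺; map⁺)
open import Data.List.Relation.Unary.Any using (here; there)
open import Data.Maybe using (just; nothing)
open import Data.Nat using (ℕ; zero; suc; _+_; _∸_; _<_; _≤_; _≡ᵇ_; _<ᵇ_; z≤n; s≤s; _≤?_; _<?_)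
open import Data.Nat.ListAction using (sum)
open import Data.Nat.Properties
open import Data.Product as Product using (_×_; _,_; proj₂)
open import Data.Sum as Sum using (_⊎_; inj₁; inj₂)
open import Function using (_∘_; id)
open import Function.Bundles using (Equivalence)
open import Function.Definitions using (Injective)
open import Relation.Binary.Definitions using (tri<; tri≈; tri>)
open import Relation.Binary.PropositionalEquality
  using (_≡_; _≢_; refl; sym; trans; cong; cong₂; subst; module ≡-Reasoning)
open import Relation.Nullary using (¬_; yes; no; contradiction)

open Equivalence using (to; from)

private
  variable
    k n m u w d x y : ℕ
    c : Colour
    C D E : Coloring

IsSymmetric : Coloring → Set
IsSymmetric C = ∀ x y → C x y ≡ C y x

infix 4 _⊑_
record _⊑_ (C D : Coloring) : Set where
  constructor extending
  field extends : ∀ x y {c} → C x y ≡ just c → D x y ≡ just c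
open _⊑_

⊑-refl : C ⊑ C
⊑-refl = extending λ _ _ → id

⊑-trans : C ⊑ D → D ⊑ E → C ⊑ E
⊑-trans C⊑D D⊑E = extending λ x y → extends D⊑E x y ∘ extends C⊑D x y

ContainsCopy-mono : ∀ {H} → C ⊑ D → ContainsCopy C c H → ContainsCopy D c H
ContainsCopy-mono C⊑D (f , f-inj , edges) = f , f-inj , λ i j ij → extends C⊑D _ _ (edges i j ij)

hits : ℕ → ℕ → ℕ → ℕ → Bool
hits u w x y = ((x ≡ᵇ u) ∧ (y ≡ᵇ w)) ∨ ((x ≡ᵇ w) ∧ (y ≡ᵇ u))

hits-refl : ∀ u w → T (hits u w u w)
hits-refl u w = from T-∨ (inj₁ (from T-∧ (≡⇒≡ᵇ u u refl , ≡⇒≡ᵇ w w refl)))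

hits-sym : ∀ u w x y → hits u w x y ≡ hits u w y x
hits-sym u w x y = trans (∨-comm ((x ≡ᵇ u) ∧ (y ≡ᵇ w)) _)
                         (cong₂ _∨_ (∧-comm (x ≡ᵇ w) _) (∧-comm (x ≡ᵇ u) _))

hits-swap : ∀ u w x y → hits u w x y ≡ hits w u x y
hits-swap u w x y = ∨-comm ((x ≡ᵇ u) ∧ (y ≡ᵇ w)) _

hits-sound : T (hits u w x y) → (x ≡ u × y ≡ w) ⊎ (x ≡ w × y ≡ u)
hits-sound {u} {w} {x} {y} =
  Sum.map (Product.map (≡ᵇ⇒≡ x u) (≡ᵇ⇒≡ y w) ∘ to T-∧)
          (Product.map (≡ᵇ⇒≡ x w) (≡ᵇ⇒≡ y u) ∘ to T-∧) ∘ to T-∨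

hits-same-edge : IsSymmetric C → T (hits u w x y) → C x y ≡ C u w
hits-same-edge {u = u} {w} {x} {y} C-sym hit with hits-sound {u} {w} {x} {y} hit
... | inj₁ (refl , refl) = refl
... | inj₂ (refl , refl) = C-sym _ _

paint-hit : ∀ C u w c → paint C u w c u w ≡ just c
paint-hit C u w c with hits u w u w | hits-refl u w
... | true | _ = refl

paint-sym : IsSymmetric C → IsSymmetric (paint C u w c)
paint-sym {C = C} {u} {w} {c} C-sym x y =
  cong₂ (λ hit z → if hit then just c else z) (hits-sym u w x y) (C-sym x y)

paint-swap : paint C u w c ⊑ paint C w u c
paint-swap {C} {u} {w} {c} = extending swapped
  where
  swapped : ∀ x y {c′} → paint C u w c x y ≡ just c′ → paint C w u c x y ≡ just c′
  swapped x y with hits u w x y | hits w u x y | hits-swap u w x y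
  ... | true  | true  | _ = id
  ... | false | false | _ = id

paint-mono : C ⊑ D → paint C u w c ⊑ paint D u w c
paint-mono {C} {D} {u} {w} {c} C⊑D = extending pointwise
  where
  pointwise : ∀ x y {c′} → paint C u w c x y ≡ just c′ → paint D u w c x y ≡ just c′
  pointwise x y with hits u w x y
  ... | true  = id
  ... | false = extends C⊑D x y

⊑-paint : IsSymmetric C → C u w ≡ nothing → C ⊑ paint C u w c
⊑-paint {C} {u} {w} {c} C-sym uw-free = extending pointwise
  where
  pointwise : ∀ x y {c′} → C x y ≡ just c′ → paint C u w c x y ≡ just c′
  pointwise x y xy-coloured with hits u w x y in hit
  ... | true  = contradiction
                  (trans (sym xy-coloured) (trans (hits-same-edge C-sym (from T-≡ hit)) uw-free)) λ ()
  ... | false = xy-coloured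

paint-⊑ : IsSymmetric D → D u w ≡ just c → paint D u w c ⊑ D
paint-⊑ {D} {u} {w} {c} D-sym uw-coloured = extending pointwise
  where
  pointwise : ∀ x y {c′} → paint D u w c x y ≡ just c′ → D x y ≡ just c′
  pointwise x y with hits u w x y in hit
  ... | true  = λ { refl → trans (hits-same-edge D-sym (from T-≡ hit)) uw-coloured }
  ... | false = id

BuilderWins-mono : ∀ {H₁ H₂ k k′} → k ≤ k′ →
                   BuilderWins H₁ H₂ k C → BuilderWins H₁ H₂ k′ C
BuilderWins-mono _         (done ended)                 = done ended
BuilderWins-mono (s≤s k≤k′) (step x y x≢y free continue) =
  step x y x≢y free λ c → BuilderWins-mono k≤k′ (continue c)

Path-adj : ∀ k {i j : Fin k} → adj (Path k) i j ≡ true →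
           suc (toℕ i) ≡ toℕ j ⊎ suc (toℕ j) ≡ toℕ i
Path-adj k {i} {j} ij with to T-∨ (from T-≡ ij)
... | inj₁ i→j = inj₁ (≡ᵇ⇒≡ _ _ i→j)
... | inj₂ j→i = inj₂ (≡ᵇ⇒≡ _ _ j→i)

pathCopy : IsSymmetric C → (g : ℕ → ℕ) → Injective _≡_ _≡_ g →
           (∀ t → suc t < k → C (g t) (g (suc t)) ≡ just c) → ContainsCopy C c (Path k)
pathCopy {C} {k} {c} C-sym g g-inj walk = g ∘ toℕ , toℕ-injective ∘ g-inj , edge
  where
  consecutive : ∀ {s t} → s < k → t < k → suc s ≡ t ⊎ suc t ≡ s → C (g s) (g t) ≡ just c
  consecutive _   t<k (inj₁ refl) = walk _ t<k
  consecutive s<k _   (inj₂ refl) = trans (C-sym _ _) (walk _ s<k)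

  edge : ∀ i j → adj (Path k) i j ≡ true → C (g (toℕ i)) (g (toℕ j)) ≡ just c
  edge i j ij = consecutive (toℕ<n i) (toℕ<n j) (Path-adj k ij)

module _ {g : ℕ → ℕ} (increasing : ∀ t → g t < g (suc t)) where

  increasing⇒strictMono : ∀ {s t} → s < t → g s < g t
  increasing⇒strictMono {s} {suc t} (s≤s s≤t) with m≤n⇒m<n∨m≡n s≤t
  ... | inj₁ s<t  = <-trans (increasing⇒strictMono s<t) (increasing t)
  ... | inj₂ refl = increasing s

  increasing⇒injective : Injective _≡_ _≡_ g
  increasing⇒injective {s} {t} gs≡gt with <-cmp s t
  ... | tri< s<t _ _ = contradiction gs≡gt (<⇒≢ (increasing⇒strictMono s<t))
  ... | tri≈ _ s≡t _ = s≡t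
  ... | tri> _ _ t<s = contradiction (sym gs≡gt) (<⇒≢ (increasing⇒strictMono t<s))

jumpAfter : ℕ → ℕ → ℕ → ℕ
jumpAfter u d t with t ≤? u
... | yes _ = t
... | no  _ = t + d

jumpAfter-≤ : ∀ {u d t} → t ≤ u → jumpAfter u d t ≡ t
jumpAfter-≤ {u} {d} {t} t≤u with t ≤? u
... | yes _   = refl
... | no  t≰u = contradiction t≤u t≰u

jumpAfter-> : ∀ {u d t} → u < t → jumpAfter u d t ≡ t + d
jumpAfter-> {u} {d} {t} u<t with t ≤? u
... | yes t≤u = contradiction t≤u (<⇒≱ u<t)
... | no  _   = refl

jumpAfter-increasing : ∀ u d t → jumpAfter u d t < jumpAfter u d (suc t)
jumpAfter-increasing u d t with <-cmp t u
... | tri< t<u _ _ rewrite jumpAfter-≤ {d = d} (<⇒≤ t<u) | jumpAfter-≤ {d = d} t<u = n<1+n t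
... | tri≈ _ refl _ rewrite jumpAfter-≤ {d = d} (≤-refl {t}) | jumpAfter-> {d = d} (n<1+n t) =
  s≤s (m≤m+n t d)
... | tri> _ _ u<t rewrite jumpAfter-> {d = d} u<t | jumpAfter-> {d = d} (m<n⇒m<1+n u<t) =
  n<1+n (t + d)

¬T⇒T-not : ∀ b → ¬ T b → T (not b)
¬T⇒T-not true  ¬b = ¬b _
¬T⇒T-not false _  = _

T-not⇒¬T : ∀ b → T (not b) → ¬ T b
T-not⇒¬T true  ()

module TwoPaths (n m : ℕ) where

  OnPath : ℕ → ℕ → Set
  OnPath x y = y < n ⊎ (n ≤ x × y < n + m)

  twoPathsEdge-sound : T (twoPathsEdge n m x y) → suc x ≡ y × OnPath x y
  twoPathsEdge-sound {x} {y} = Product.map (≡ᵇ⇒≡ (suc x) y) (decode ∘ to T-∨) ∘ to T-∧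
    where
    decode : T (y <ᵇ n) ⊎ T (not (x <ᵇ n) ∧ (y <ᵇ n + m)) → OnPath x y
    decode = Sum.map (<ᵇ⇒< y n)
                     (Product.map (λ x≮n → ≮⇒≥ (T-not⇒¬T (x <ᵇ n) x≮n ∘ <⇒<ᵇ)) (<ᵇ⇒< y (n + m))
                        ∘ to T-∧)

  twoPathsEdge-complete : suc x ≡ y → OnPath x y → T (twoPathsEdge n m x y)
  twoPathsEdge-complete {x} refl onPath =
    from T-∧ (≡⇒≡ᵇ (suc x) (suc x) refl , from T-∨ (encode onPath))
    where
    encode : OnPath x (suc x) → T (suc x <ᵇ n) ⊎ T (not (x <ᵇ n) ∧ (suc x <ᵇ n + m))
    encode = Sum.map <⇒<ᵇ λ (n≤x , y<n+m) →
      from T-∧ (¬T⇒T-not (x <ᵇ n) (≤⇒≯ n≤x ∘ <ᵇ⇒< x n) , <⇒<ᵇ y<n+m)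

  twoPaths-sym : IsSymmetric (twoPaths n m)
  twoPaths-sym x y = cong (λ edge → if edge then just blue else nothing)
                          (∨-comm (twoPathsEdge n m x y) (twoPathsEdge n m y x))

  twoPaths-blue : suc x ≡ y → OnPath x y → twoPaths n m x y ≡ just blue
  twoPaths-blue {x} {y} x→y onPath
    with twoPathsEdge n m x y | twoPathsEdge-complete x→y onPath
  ... | true | _ = refl

  twoPaths-cross : x < n → n ≤ y → twoPaths n m x y ≡ nothing
  twoPaths-cross {x} {y} x<n n≤y
    with twoPathsEdge n m x y in forward | twoPathsEdge n m y x in backward
  ... | false | false = refl
  ... | true  | _     with twoPathsEdge-sound (from T-≡ forward)
  ...   | _ , inj₁ y<n       = contradiction y<n (≤⇒≯ n≤y)
  ...   | _ , inj₂ (n≤x , _) = contradiction x<n (≤⇒≯ n≤x)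
  twoPaths-cross x<n n≤y | false | true with twoPathsEdge-sound (from T-≡ backward)
  ... | refl , _ = contradiction x<n (≤⇒≯ (m≤n⇒m≤1+n n≤y))

  secondPath : k ≤ m → ContainsCopy (twoPaths n m) blue (Path k)
  secondPath {k} k≤m = pathCopy twoPaths-sym (_+ n) (+-cancelʳ-≡ n _ _) walk
    where
    walk : ∀ t → suc t < k → twoPaths n m (t + n) (suc t + n) ≡ just blue
    walk t t+1<k = twoPaths-blue refl
      (inj₂ (m≤n+m n t , subst (suc t + n <_) (+-comm m n) (+-monoˡ-< n (<-≤-trans t+1<k k≤m))))

  module _ (E-sym : IsSymmetric E) (base : twoPaths n m ⊑ E) where

    bridgedPath : u < n → n ≤ suc (u + d) → k + d ≤ n + m → E u (suc (u + d)) ≡ just blue →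
                  ContainsCopy E blue (Path k)
    bridgedPath {u} {d} {k} u<n n≤w k+d≤n+m bridge =
      pathCopy E-sym (jumpAfter u d) (increasing⇒injective (jumpAfter-increasing u d)) walk
      where
      walk : ∀ t → suc t < k → E (jumpAfter u d t) (jumpAfter u d (suc t)) ≡ just blue
      walk t t+1<k with <-cmp t u
      ... | tri< t<u _ _ rewrite jumpAfter-≤ {d = d} (<⇒≤ t<u) | jumpAfter-≤ {d = d} t<u =
        extends base _ _ (twoPaths-blue refl (inj₁ (≤-<-trans t<u u<n)))
      ... | tri≈ _ refl _ rewrite jumpAfter-≤ {d = d} (≤-refl {t}) | jumpAfter-> {d = d} (n<1+n t) =
        bridge
      ... | tri> _ _ u<t rewrite jumpAfter-> {d = d} u<t | jumpAfter-> {d = d} (m<n⇒m<1+n u<t) =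
        extends base _ _ (twoPaths-blue refl
          (inj₂ (≤-trans n≤w (+-monoˡ-≤ d u<t) , <-≤-trans (+-monoˡ-< d t+1<k) k+d≤n+m)))

true-or-false : ∀ b → b ≡ true ⊎ b ≡ false
true-or-false true  = inj₁ refl
true-or-false false = inj₂ refl

countBelow : ∀ {N} → (Fin N → Bool) → Fin N → ℕ
countBelow P zero    = 0
countBelow P (suc i) = (if P zero then 1 else 0) + countBelow (P ∘ suc) i

countBelow-complement : ∀ {N} (P : Fin N → Bool) i →
                        countBelow P i + countBelow (not ∘ P) i ≡ toℕ i
countBelow-complement P zero = refl
countBelow-complement P (suc i) with P zero
... | true  = cong suc (countBelow-complement (P ∘ suc) i)
... | false = trans (+-suc (countBelow (P ∘ suc) i) _) (cong suc (countBelow-complement (P ∘ suc) i))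

countBelow-< : ∀ {N} (P : Fin N → Bool) {i j} → toℕ i < toℕ j → P i ≡ true →
               countBelow P i < countBelow P j
countBelow-< P {zero}  {suc j} _         P0 rewrite P0 = s≤s z≤n
countBelow-< P {suc i} {suc j} (s≤s i<j) Pi =
  +-monoʳ-< (if P zero then 1 else 0) (countBelow-< (P ∘ suc) i<j Pi)

countBelow-injective : ∀ {N} (P : Fin N → Bool) {i j} → P i ≡ true → P j ≡ true →
                       countBelow P i ≡ countBelow P j → i ≡ j
countBelow-injective P {i} {j} Pi Pj same with <-cmp (toℕ i) (toℕ j)
... | tri< i<j _ _ = contradiction same (<⇒≢ (countBelow-< P i<j Pi))
... | tri≈ _ i≡j _ = toℕ-injective i≡j
... | tri> _ _ j<i = contradiction (sym same) (<⇒≢ (countBelow-< P j<i Pj))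

countBelow-across : ∀ {N} (P : Fin N → Bool) {i j} → P i ≡ true → P j ≡ false →
                    countBelow P i + countBelow (not ∘ P) j < N
countBelow-across {N} P {i} {j} Pi Pj with <-cmp (toℕ i) (toℕ j)
... | tri< i<j _ _ = begin-strict
  countBelow P i + countBelow (not ∘ P) j <⟨ +-monoˡ-< _ (countBelow-< P i<j Pi) ⟩
  countBelow P j + countBelow (not ∘ P) j ≡⟨ countBelow-complement P j ⟩
  toℕ j                                   <⟨ toℕ<n j ⟩
  N                                       ∎
  where open ≤-Reasoning
... | tri≈ _ i≡j _ = contradiction (trans (sym Pi) (trans (cong P (toℕ-injective i≡j)) Pj)) λ ()
... | tri> _ _ j<i = begin-strict
  countBelow P i + countBelow (not ∘ P) j <⟨ +-monoʳ-< _ (countBelow-< (not ∘ P) j<i (cong not Pj)) ⟩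
  countBelow P i + countBelow (not ∘ P) i ≡⟨ countBelow-complement P i ⟩
  toℕ i                                   <⟨ toℕ<n i ⟩
  N                                       ∎
  where open ≤-Reasoning

module BipartiteEmbedding (n : ℕ) (H : Graph) (side : Fin (size H) → Bool) (N<n : size H < n) where

  leftRank rightRank : Fin (size H) → ℕ
  leftRank  = countBelow side
  rightRank = countBelow (not ∘ side)

  embed : Fin (size H) → ℕ
  embed i = if side i then n ∸ suc (leftRank i) else n + rightRank i

  leftRank<n : ∀ i → leftRank i < n
  leftRank<n i = begin-strict
    leftRank i                 ≤⟨ m≤m+n _ (rightRank i) ⟩
    leftRank i + rightRank i   ≡⟨ countBelow-complement side i ⟩
    toℕ i                      <⟨ toℕ<n i ⟩
    size H                     <⟨ N<n ⟩
    n                          ∎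
    where open ≤-Reasoning

  embed-left : ∀ {i} → side i ≡ true → embed i + suc (leftRank i) ≡ n
  embed-left {i} left rewrite left = m∸n+n≡m (leftRank<n i)

  embed-right : ∀ {i} → side i ≡ false → embed i ≡ n + rightRank i
  embed-right right rewrite right = refl

  embed-left-< : ∀ {i} → side i ≡ true → embed i < n
  embed-left-< {i} left = subst (embed i <_) (embed-left left) (m<m+n _ (s≤s z≤n))

  embed-right-≥ : ∀ {i} → side i ≡ false → n ≤ embed i
  embed-right-≥ {i} right = subst (n ≤_) (sym (embed-right right)) (m≤m+n n _)

  embed-injective : Injective _≡_ _≡_ embed
  embed-injective {i} {j} same with true-or-false (side i) | true-or-false (side j)
  ... | inj₁ li | inj₁ lj =
    countBelow-injective side li lj (suc-injective (+-cancelˡ-≡ (embed i) _ _ (begin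
      embed i + suc (leftRank i) ≡⟨ embed-left li ⟩
      n                          ≡⟨ embed-left lj ⟨
      embed j + suc (leftRank j) ≡⟨ cong (_+ suc (leftRank j)) same ⟨
      embed i + suc (leftRank j) ∎)))
    where open ≡-Reasoning
  ... | inj₂ ri | inj₂ rj =
    countBelow-injective (not ∘ side) (cong not ri) (cong not rj)
      (+-cancelˡ-≡ n _ _ (trans (sym (embed-right ri)) (trans same (embed-right rj))))
  ... | inj₁ li | inj₂ rj =
    contradiction same (<⇒≢ (<-≤-trans (embed-left-< li) (embed-right-≥ rj)))
  ... | inj₂ ri | inj₁ lj =
    contradiction (sym same) (<⇒≢ (<-≤-trans (embed-left-< lj) (embed-right-≥ ri)))

  embed-across : ∀ {a b} → side a ≡ true → side b ≡ false →
                 embed b ≡ suc (embed a + (leftRank a + rightRank b))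
  embed-across {a} {b} left right = begin
    embed b                                        ≡⟨ embed-right right ⟩
    n + rightRank b                                ≡⟨ cong (_+ rightRank b) (embed-left left) ⟨
    embed a + suc (leftRank a) + rightRank b       ≡⟨ +-assoc (embed a) _ _ ⟩
    embed a + suc (leftRank a + rightRank b)       ≡⟨ +-suc (embed a) _ ⟩
    suc (embed a + (leftRank a + rightRank b))     ∎
    where open ≡-Reasoning

IsEdge : (H : Graph) → Fin (size H) × Fin (size H) → Set
IsEdge H (i , j) = adj H i j ≡ true

adj⇒≢ : ∀ H {i j} → adj H i j ≡ true → i ≢ j
adj⇒≢ H {i} ii refl = contradiction (trans (sym ii) (irrefl H i)) λ ()

length-concatMap : ∀ {A B : Set} (F : A → List B) xs →
                   length (concatMap F xs) ≡ sum (map (length ∘ F) xs)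
length-concatMap F []       = refl
length-concatMap F (x ∷ xs) = trans (length-++ (F x)) (cong (length (F x) +_) (length-concatMap F xs))

All-concatMap⁺ : ∀ {A B : Set} {P : B → Set} (F : A → List B) xs →
                 (∀ x → All P (F x)) → All P (concatMap F xs)
All-concatMap⁺ F xs all-F = concat⁺ (map⁺ (All.tabulate {xs = xs} λ {x} _ → all-F x))

module _ (H : Graph) where

  private
    N = size H

    Forward : Fin N → Fin N → Bool
    Forward i j = (toℕ i <ᵇ toℕ j) ∧ adj H i j

    entry : Fin N → Fin N → List (Fin N × Fin N)
    entry i j = if Forward i j then [ (i , j) ] else []

    row : Fin N → List (Fin N × Fin N)
    row i = concatMap (entry i) (allFin N)

  edgeList : List (Fin N × Fin N)
  edgeList = concatMap row (allFin N)

  length-edgeList : length edgeList ≡ e H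
  length-edgeList = trans (length-concatMap row (allFin N)) (cong sum (map-cong length-row (allFin N)))
    where
    length-row : ∀ i → length (row i) ≡ sum (map (λ j → if Forward i j then 1 else 0) (allFin N))
    length-row i = trans (length-concatMap (entry i) (allFin N))
                         (cong sum (map-cong (λ j → if-float length (Forward i j)) (allFin N)))

  edgeList-adj : All (IsEdge H) edgeList
  edgeList-adj =
    All-concatMap⁺ row (allFin N) λ i → All-concatMap⁺ (entry i) (allFin N) (entry-adj i)
    where
    entry-adj : ∀ i j → All (IsEdge H) (entry i j)
    entry-adj i j with Forward i j in forward
    ... | true  = to T-≡ (proj₂ (to T-∧ (from T-≡ forward))) ∷ []
    ... | false = []

  edgeList-complete : ∀ {i j} → toℕ i < toℕ j → adj H i j ≡ true → (i , j) ∈ edgeList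
  edgeList-complete {i} {j} i<j ij =
    ∈-concatMap⁺ row (lose (∈-allFin i) (∈-concatMap⁺ (entry i) (lose (∈-allFin j) entry-∈)))
    where
    entry-∈ : (i , j) ∈ entry i j
    entry-∈ rewrite to T-≡ (from T-∧ (<⇒<ᵇ i<j , from T-≡ ij)) = here refl

  edgeList-covers : ∀ {i j} → adj H i j ≡ true → (i , j) ∈ edgeList ⊎ (j , i) ∈ edgeList
  edgeList-covers {i} {j} ij with <-cmp (toℕ i) (toℕ j)
  ... | tri< i<j _ _ = inj₁ (edgeList-complete i<j ij)
  ... | tri≈ _ i≡j _ = contradiction (toℕ-injective i≡j) (adj⇒≢ H ij)
  ... | tri> _ _ j<i = inj₂ (edgeList-complete j<i (trans (Graph.sym H j i) ij))

module ImageEdgeStrategy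
  (H H′ : Graph) (f : Fin (size H) → ℕ) (f-injective : Injective _≡_ _≡_ f) (C : Coloring)
  (blue-ends : ∀ a b → adj H a b ≡ true → ContainsCopy (paint C (f a) (f b) blue) blue H′)
  where

  RedOrListed : Coloring → List (Fin (size H) × Fin (size H)) → Set
  RedOrListed D L =
    ∀ i j → adj H i j ≡ true → D (f i) (f j) ≡ just red ⊎ ((i , j) ∈ L ⊎ (j , i) ∈ L)

  redOrListed-next : ∀ {D D′ a b L} → IsSymmetric D′ → D ⊑ D′ → D′ (f a) (f b) ≡ just red →
                     RedOrListed D ((a , b) ∷ L) → RedOrListed D′ L
  redOrListed-next D′-sym D⊑D′ ab-red rol i j ij with rol i j ij
  ... | inj₁ ij-red                = inj₁ (extends D⊑D′ _ _ ij-red)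
  ... | inj₂ (inj₁ (here refl))    = inj₁ ab-red
  ... | inj₂ (inj₂ (here refl))    = inj₁ (trans (D′-sym _ _) ab-red)
  ... | inj₂ (inj₁ (there listed)) = inj₂ (inj₁ listed)
  ... | inj₂ (inj₂ (there listed)) = inj₂ (inj₂ listed)

  allRed : ∀ D → RedOrListed D [] → ContainsCopy D red H
  allRed D rol = f , f-injective , λ i j ij → unlisted (rol i j ij)
    where
    unlisted : ∀ {A : Set} {p q : Fin (size H) × Fin (size H)} → A ⊎ (p ∈ [] ⊎ q ∈ []) → A
    unlisted (inj₁ a) = a
    unlisted (inj₂ (inj₁ ()))
    unlisted (inj₂ (inj₂ ()))

  builderWins : ∀ L D → All (IsEdge H) L → IsSymmetric D → C ⊑ D → RedOrListed D L →
                BuilderWins H H′ (length L) D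
  builderWins []            D _         _     _   rol = done (inj₁ (allRed D rol))
  -- An image edge that is already red needs no question; one that is already blue ends the
  -- game just as a blue answer would.
  builderWins ((a , b) ∷ L) D (ab ∷ Ls) D-sym C⊑D rol with D (f a) (f b) in ab-colour
  ... | just red  = BuilderWins-mono (n≤1+n _)
                      (builderWins L D Ls D-sym C⊑D (redOrListed-next {D} D-sym ⊑-refl ab-colour rol))
  ... | just blue = done (inj₂ (ContainsCopy-mono {H = H′} (⊑-trans (paint-mono C⊑D) (paint-⊑ D-sym ab-colour))
                                 (blue-ends a b ab)))
  ... | nothing   = step (f a) (f b) (adj⇒≢ H ab ∘ f-injective) ab-colour answer
    where
    answer : ∀ c → BuilderWins H H′ (length L) (paint D (f a) (f b) c)
    answer red  = builderWins L _ Ls (paint-sym D-sym) (⊑-trans C⊑D D⊑D′)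
                    (redOrListed-next {D} (paint-sym D-sym) D⊑D′ (paint-hit D (f a) (f b) red) rol)
      where D⊑D′ = ⊑-paint D-sym ab-colour
    answer blue = done (inj₂ (ContainsCopy-mono {H = H′} (paint-mono C⊑D) (blue-ends a b ab)))

module _ (n m : ℕ) (H : Graph) (side : Fin (size H) → Bool)
         (proper : ∀ i j → adj H i j ≡ true → side i ≢ side j) (N<n : size H < n) where

  open TwoPaths n m
  open BipartiteEmbedding n H side N<n

  private
    K = n + m ∸ size H

  leftToRight-bridges : ∀ {a b} → side a ≡ true → side b ≡ false →
                        ContainsCopy (paint (twoPaths n m) (embed a) (embed b) blue) blue (Path K)
  leftToRight-bridges {a} {b} left right =
    bridgedPath (paint-sym twoPaths-sym) (⊑-paint twoPaths-sym (twoPaths-cross a<n n≤b))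
                a<n (subst (n ≤_) (embed-across left right) n≤b) K+d≤n+m
                (subst (λ w → paint (twoPaths n m) (embed a) (embed b) blue (embed a) w ≡ just blue)
                       (embed-across left right) (paint-hit (twoPaths n m) (embed a) (embed b) blue))
    where
    a<n = embed-left-< left
    n≤b = embed-right-≥ right
    K+d≤n+m : K + (leftRank a + rightRank b) ≤ n + m
    K+d≤n+m = begin
      K + (leftRank a + rightRank b) ≤⟨ +-monoʳ-≤ K (<⇒≤ (countBelow-across side left right)) ⟩
      K + size H                     ≡⟨ m∸n+n≡m (≤-trans (<⇒≤ N<n) (m≤m+n n m)) ⟩
      n + m                          ∎
      where open ≤-Reasoning

  edge-bridges : ∀ a b → adj H a b ≡ true →
                 ContainsCopy (paint (twoPaths n m) (embed a) (embed b) blue) blue (Path K)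
  edge-bridges a b ab with true-or-false (side a) | true-or-false (side b)
  ... | inj₁ left | inj₂ right = leftToRight-bridges left right
  ... | inj₂ right | inj₁ left =
    ContainsCopy-mono {H = Path K} (paint-swap {C = twoPaths n m}) (leftToRight-bridges left right)
  ... | inj₁ sa | inj₁ sb = contradiction (trans sa (sym sb)) (proper a b ab)
  ... | inj₂ sa | inj₂ sb = contradiction (trans sa (sym sb)) (proper a b ab)

  builderWins-embedding : BuilderWins H (Path K) (e H) (twoPaths n m)
  builderWins-embedding = subst (λ k → BuilderWins H (Path K) k (twoPaths n m)) (length-edgeList H)
    (builderWins (edgeList H) (twoPaths n m) (edgeList-adj H) twoPaths-sym ⊑-refl
                 λ _ _ ij → inj₂ (edgeList-covers H ij))
    where open ImageEdgeStrategy H (Path K) embed embed-injective (twoPaths n m) edge-bridges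

lemma2 : (n m : ℕ) → 0 < n → 0 < m → (H : Graph) → Bipartite H →
           BuilderWins H (Path (n + m ∸ v H)) (e H) (twoPaths n m)
lemma2 n m _ _ H (side , proper) with size H <? n
... | yes N<n = builderWins-embedding n m H side proper N<n
... | no  N≮n = done (inj₂ (TwoPaths.secondPath n m K≤m))
  where
  K≤m : n + m ∸ size H ≤ m
  K≤m = ≤-trans (∸-monoʳ-≤ (n + m) (≮⇒≥ N≮n)) (≤-reflexive (m+n∸m≡n n m))
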